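{- $$\sum_{\pi}x^{|\pi|}y^{\mathrm{descents}(\pi)}=(1+x)C(x^2y),$$ the sum over all Dumont permutations $\pi$ (of all lengths, including the empty one) avoiding $132$. Equivalently, for every $k\geq0$ the generating function $\sum_n e_{n,k}x^n$, where $e_{n,k}$ is the number of $132$-avoiding Dumont permutations of length $n$ with exactly $k$ descents, equals $C_kx^{2k}+C_kx^{2k+1}$.
   Context: A permutation $\pi=\pi_1\cdots\pi_n\in S_n$ is a Dumont permutation (of the first kind) if every even entry $\pi_i$ is followed by a smaller entry ($i<n$ and $\pi_{i+1}<\pi_i$) and every odd entry $\pi_i$ is either last ($i=n$) or followed by a larger entry; the empty permutation is a Dumont permutation. $\pi$ avoids $132$ if there are no $i<j<l$ with $\pi_i<\pi_l<\pi_j$. $|\pi|$ is the length of $\pi$; a descent of $\pi$ is an index $j\in\{1,\dots,n-1\}$ with $\pi_j>\pi_{j+1}$, and $\mathrm{descents}(\pi)$ is their number. $C_m=\frac1{m+1}\binom{2m}{m}$ and $C(x)=\sum_{m\geq0}C_mx^m=\frac{1-\sqrt{1-4x}}{2x}$. -}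

module Defs where

open import Data.Nat using (ℕ; zero; suc; _+_; _*_; _<_; _≡ᵇ_; _/_; _%_)
open import Data.Nat.Combinatorics using (_C_)
open import Data.Nat.Properties using ()
open import Relation.Binary.PropositionalEquality using (_≡_)
open import Data.List using (List; []; _∷_; map; upTo)
open import Data.List.Relation.Binary.Sublist.Propositional using (_⊆_)
open import Data.Product using (_×_)
open import Data.Sum using (_⊎_)
open import Data.Unit using (⊤)
open import Data.Bool using (if_then_else_)
open import Relation.Nullary using (¬_)

Even : ℕ → Set
Even a = a % 2 ≡ 0

Odd : ℕ → Set
Odd a = a % 2 ≡ 1

oneTo : ℕ → List ℕ
oneTo n = map suc (upTo n)

Dumont : List ℕ → Set
Dumont [] = ⊤
Dumont (a ∷ []) = Odd a
Dumont (a ∷ b ∷ rest) = ((Even a × b < a) ⊎ (Odd a × a < b)) × Dumont (b ∷ rest)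

Avoids132 : List ℕ → Set
Avoids132 π = ∀ a b c → (a ∷ b ∷ c ∷ []) ⊆ π → ¬ (a < c × c < b)

descents : List ℕ → ℕ
descents [] = 0
descents (a ∷ []) = 0
descents (a ∷ b ∷ rest) = (if b Data.Nat.<ᵇ a then 1 else 0) + descents (b ∷ rest)

catalan : ℕ → ℕ
catalan m = ((2 * m) C m) / suc m

-- coefficient of x^n y^k in (1 + x) C(x^2 y):  C_k if n = 2k or n = 2k+1, else 0
coeff : ℕ → ℕ → ℕ
coeff n k = if n ≡ᵇ 2 * k then catalan k
            else if n ≡ᵇ suc (2 * k) then catalan k else 0

{-# OPTIONS --safe #-}
-- A 132-avoiding permutation splits at its maximum M as α M β with α a 132-avoiding arrangement of
-- the values above those of β. In a Dumont permutation M odd forces β = [], M even forces β ≠ [],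
-- and the minimum of a nonempty α is odd. Hence the 132-avoiding Dumont permutations of length
-- 2m + 1 are those of length 2m followed by the new maximum, while those of length 2m + 2 are the
-- α M β with (|α|, |β|) equal to (0, 2m + 1) or to (2r + 1, 2s) with s ≥ 1 and s + r = m. Both
-- counts therefore obey the Catalan recursion, which (2k choose k)/(k + 1) satisfies by the
-- classical first-passage decomposition of ballot paths. Finally, the descent tops of a Dumont
-- permutation are exactly its even entries, so a Dumont permutation of [n] has ⌊n/2⌋ descents.
module Submission where

open import Defs
open import Data.Nat using (ℕ)
open import Data.List using (List; length)
open import Data.List.Membership.Propositional using (_∈_)
open import Data.List.Relation.Unary.Unique.Propositional using (Unique)
open import Data.List.Relation.Binary.Permutation.Propositional using (_↭_)
open import Data.Product using (_×_; ∃-syntax)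
open import Function.Bundles using (_⇔_)
open import Relation.Binary.PropositionalEquality using (_≡_)

open import Data.Nat
open import Data.Nat.Properties
open import Data.Nat.Combinatorics
  using (_C_; nCk≡nC[n∸k]; nC1≡n) renaming (nCk+nC[k+1]≡[n+1]C[k+1] to pascal)
open import Data.Nat.DivMod using (m*n/n≡m; m*n%n≡0; [m+kn]%n≡m%n; %-distribˡ-+)
open import Data.Nat.Induction using (<-rec)
open import Data.Nat.Tactic.RingSolver using (solve-∀)
open import Data.Bool using (true; false; if_then_else_)
open import Data.Unit using (tt)
open import Data.Empty using (⊥; ⊥-elim)
open import Data.Product using (_,_; proj₁; proj₂; uncurry)
open import Data.Sum using (_⊎_; inj₁; inj₂)
open import Data.List using ([]; _∷_; _++_; [_]; map; filter; applyUpTo; cartesianProduct)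
open import Data.List.Properties
  using (length-++; length-map; ∷-injectiveˡ; ∷-injectiveʳ; ++-assoc; ++-identityʳ; map-upTo
        ; filter-++; filter-all; filter-none; filter-accept; filter-reject)
open import Data.List.Extrema.Nat using (max; ⊥≤max; xs≤max; max<v⁺; max≤v⁺)
open import Data.List.Membership.Propositional using (_∉_)
open import Data.List.Membership.Propositional.Properties
  using ( ∈-++⁺ˡ; ∈-++⁺ʳ; ∈-++⁻; ∈-∃++; ∈-map⁺; ∈-map⁻
        ; ∈-cartesianProduct⁺; ∈-cartesianProduct⁻)
open import Data.List.Relation.Unary.Any using (here; there)
open import Data.List.Relation.Unary.All as All using (All; []; _∷_)
import Data.List.Relation.Unary.All.Properties as Allₚ
open import Data.List.Relation.Unary.Unique.Propositional using ([]; _∷_)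
import Data.List.Relation.Unary.Unique.Propositional.Properties as Uniqueₚ
open import Data.List.Relation.Binary.Permutation.Propositional
  using (↭-refl; ↭-sym; ↭-trans; ↭-reflexive; prep; ↭⇒↭ₛ; module PermutationReasoning)
open import Data.List.Relation.Binary.Permutation.Propositional.Properties
  using (∈-resp-↭; ↭-empty-inv; ↭-length; drop-mid; filter-↭; ++-comm; ++⁺; ∷↭∷ʳ)
import Data.List.Relation.Binary.Permutation.Setoid.Properties as ↭ₛ
open import Data.List.Relation.Binary.Sublist.Propositional as Sublist
  using (_⊆_; []; _∷_; to∈; from∈; ⊆-trans; ⊆-refl)
import Data.List.Relation.Binary.Sublist.Propositional.Properties as ⊆
open import Function using (_∘_)
open import Function.Bundles using (mk⇔; Equivalence)
open import Function.Properties.Equivalence using () renaming (sym to ⇔-sym)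
open import Relation.Nullary using (¬_; yes; no; contradiction)
open import Relation.Nullary.Decidable using (dec-true; dec-false)
open import Relation.Unary using (Decidable)
open import Relation.Binary.PropositionalEquality
  using (_≢_; refl; sym; trans; cong; cong₂; subst; subst₂; ≢-sym; module ≡-Reasoning)
open import Relation.Binary.PropositionalEquality.Properties using (setoid)

open Equivalence using (to; from)

private
  variable
    A B : Set
    P Q : A → Set
    m n : ℕ

-- Catalan numbers

splitSum : (ℕ → ℕ → ℕ) → ℕ → ℕ
splitSum f zero    = f 0 0
splitSum f (suc n) = f 0 (suc n) + splitSum (λ i j → f (suc i) j) n

splitSum-cong : ∀ {f g} → (∀ i j → f i j ≡ g i j) → ∀ n → splitSum f n ≡ splitSum g n
splitSum-cong f≗g zero    = f≗g 0 0
splitSum-cong f≗g (suc n) = cong₂ _+_ (f≗g 0 (suc n)) (splitSum-cong (λ i → f≗g (suc i)) n)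

splitSum-+ : ∀ f g n → splitSum (λ i j → f i j + g i j) n ≡ splitSum f n + splitSum g n
splitSum-+ f g zero    = refl
splitSum-+ f g (suc n) = begin
  f 0 (suc n) + g 0 (suc n) + splitSum (λ i j → f (suc i) j + g (suc i) j) n
    ≡⟨ cong (f 0 (suc n) + g 0 (suc n) +_) (splitSum-+ (λ i → f (suc i)) (λ i → g (suc i)) n) ⟩
  f 0 (suc n) + g 0 (suc n) + (splitSum (λ i → f (suc i)) n + splitSum (λ i → g (suc i)) n)
    ≡⟨ +-exchange (f 0 (suc n)) (g 0 (suc n)) _ _ ⟩
  f 0 (suc n) + splitSum (λ i → f (suc i)) n + (g 0 (suc n) + splitSum (λ i → g (suc i)) n) ∎
  where
  open ≡-Reasoning
  +-exchange : ∀ a b c d → a + b + (c + d) ≡ a + c + (b + d)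
  +-exchange = solve-∀

splitSum-last : ∀ f n → splitSum f (suc n) ≡ splitSum (λ i j → f i (suc j)) n + f (suc n) 0
splitSum-last f zero    = refl
splitSum-last f (suc n) = begin
  f 0 (suc (suc n)) + splitSum (λ i j → f (suc i) j) (suc n)
    ≡⟨ cong (f 0 (suc (suc n)) +_) (splitSum-last (λ i → f (suc i)) n) ⟩
  f 0 (suc (suc n)) + (splitSum (λ i j → f (suc i) (suc j)) n + f (suc (suc n)) 0)
    ≡⟨ +-assoc (f 0 (suc (suc n))) _ _ ⟨
  f 0 (suc (suc n)) + splitSum (λ i j → f (suc i) (suc j)) n + f (suc (suc n)) 0 ∎
  where open ≡-Reasoning

-- ballot b h counts the ±1-step paths from height h down to 0 with b up-steps that never go below 0.
ballot : ℕ → ℕ → ℕ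
ballot zero    h       = 1
ballot (suc b) zero    = ballot b 1
ballot (suc b) (suc h) = ballot (suc b) h + ballot b (suc (suc h))

-- Cut a path from height h + 1 at its first visit to height h.
ballot-convolution : ∀ b h → ballot b (suc h) ≡ splitSum (λ i j → ballot i 0 * ballot j h) b
ballot-convolution zero    h       = refl
ballot-convolution (suc b) zero    = begin
  ballot b 1 + ballot b 2
    ≡⟨ cong (ballot b 1 +_) (ballot-convolution b 1) ⟩
  ballot b 1 + splitSum (λ i j → ballot i 0 * ballot j 1) b
    ≡⟨ +-comm (ballot b 1) _ ⟩
  splitSum (λ i j → ballot i 0 * ballot j 1) b + ballot b 1
    ≡⟨ cong (splitSum (λ i j → ballot i 0 * ballot j 1) b +_) (*-identityʳ (ballot b 1)) ⟨
  splitSum (λ i j → ballot i 0 * ballot j 1) b + ballot (suc b) 0 * 1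
    ≡⟨ splitSum-last (λ i j → ballot i 0 * ballot j 0) b ⟨
  splitSum (λ i j → ballot i 0 * ballot j 0) (suc b) ∎
  where open ≡-Reasoning
ballot-convolution (suc b) (suc h) = begin
  ballot (suc b) (suc h) + ballot b (3 + h)
    ≡⟨ cong₂ _+_ (ballot-convolution (suc b) h) (ballot-convolution b (2 + h)) ⟩
  splitSum (λ i j → c i * ballot j h) (suc b) + splitSum (λ i j → c i * ballot j (2 + h)) b
    ≡⟨ cong (_+ splitSum (λ i j → c i * ballot j (2 + h)) b) (splitSum-last (λ i j → c i * ballot j h) b) ⟩
  splitSum (λ i j → c i * ballot (suc j) h) b + c (suc b) * 1 + splitSum (λ i j → c i * ballot j (2 + h)) b
    ≡⟨ +-rearrange (splitSum (λ i j → c i * ballot (suc j) h) b) (c (suc b) * 1) _ ⟩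
  splitSum (λ i j → c i * ballot (suc j) h) b + splitSum (λ i j → c i * ballot j (2 + h)) b + c (suc b) * 1
    ≡⟨ cong (_+ c (suc b) * 1) (splitSum-+ (λ i j → c i * ballot (suc j) h) (λ i j → c i * ballot j (2 + h)) b) ⟨
  splitSum (λ i j → c i * ballot (suc j) h + c i * ballot j (2 + h)) b + c (suc b) * 1
    ≡⟨ cong (_+ c (suc b) * 1) (splitSum-cong (λ i j → *-distribˡ-+ (c i) (ballot (suc j) h) _) b) ⟨
  splitSum (λ i j → c i * ballot (suc j) (suc h)) b + c (suc b) * 1
    ≡⟨ splitSum-last (λ i j → c i * ballot j (suc h)) b ⟨
  splitSum (λ i j → c i * ballot j (suc h)) (suc b) ∎
  where
  open ≡-Reasoning
  c : ℕ → ℕ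
  c i = ballot i 0
  +-rearrange : ∀ x y z → x + y + z ≡ x + z + y
  +-rearrange = solve-∀

C-sym : ∀ a b → (a + b) C a ≡ (a + b) C b
C-sym a b = trans (nCk≡nC[n∸k] (m≤m+n a b)) (cong ((a + b) C_) (m+n∸m≡n a b))

-- The reflection principle ballot (suc b) h = N C suc b ∸ N C b, N = 2 * suc b + h, stated additively.
ballot-binomial : ∀ b h → ballot (suc b) h + (2 * suc b + h) C b ≡ (2 * suc b + h) C suc b
ballot-binomial zero zero = refl
ballot-binomial zero (suc h) = begin
  ballot 1 h + 1 + 1
    ≡⟨ cong (_+ 1) (ballot-binomial zero h) ⟩
  (2 + h) C 1 + 1
    ≡⟨ +-comm ((2 + h) C 1) 1 ⟩
  (2 + h) C 0 + (2 + h) C 1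
    ≡⟨ pascal (2 + h) 0 ⟩
  (3 + h) C 1 ∎
  where open ≡-Reasoning
ballot-binomial (suc b) zero = begin
  ballot (suc b) 1 + N C suc b
    ≡⟨ cong (λ n → ballot (suc b) 1 + n C suc b) N≡ ⟩
  ballot (suc b) 1 + suc N′ C suc b
    ≡⟨ cong (ballot (suc b) 1 +_) (pascal N′ b) ⟨
  ballot (suc b) 1 + (N′ C b + N′ C suc b)
    ≡⟨ +-assoc (ballot (suc b) 1) _ _ ⟨
  ballot (suc b) 1 + N′ C b + N′ C suc b
    ≡⟨ cong (_+ N′ C suc b) (ballot-binomial b 1) ⟩
  N′ C suc b + N′ C suc b
    ≡⟨ cong (N′ C suc b +_) middle-symmetry ⟩
  N′ C suc b + N′ C suc (suc b)
    ≡⟨ pascal N′ (suc b) ⟩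
  suc N′ C suc (suc b)
    ≡⟨ cong (_C suc (suc b)) N≡ ⟨
  N C suc (suc b) ∎
  where
  open ≡-Reasoning
  N N′ : ℕ
  N  = 2 * suc (suc b) + 0
  N′ = 2 * suc b + 1
  N≡ : N ≡ suc N′
  N≡ = lemma b
    where lemma : ∀ b → 2 * suc (suc b) + 0 ≡ suc (2 * suc b + 1)
          lemma = solve-∀
  middle-symmetry : N′ C suc b ≡ N′ C suc (suc b)
  middle-symmetry = begin
    N′ C suc b                          ≡⟨ cong (_C suc b) N′≡ ⟩
    (suc b + suc (suc b)) C suc b       ≡⟨ C-sym (suc b) (suc (suc b)) ⟩
    (suc b + suc (suc b)) C suc (suc b) ≡⟨ cong (_C suc (suc b)) N′≡ ⟨
    N′ C suc (suc b)                    ∎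
    where N′≡ : N′ ≡ suc b + suc (suc b)
          N′≡ = lemma b
            where lemma : ∀ b → 2 * suc b + 1 ≡ suc b + suc (suc b)
                  lemma = solve-∀
ballot-binomial (suc b) (suc h) = begin
  ballot (2 + b) h + ballot (suc b) (2 + h) + N C suc b
    ≡⟨ cong (λ n → ballot (2 + b) h + ballot (suc b) (2 + h) + n C suc b) N≡ ⟩
  ballot (2 + b) h + ballot (suc b) (2 + h) + suc N′ C suc b
    ≡⟨ cong (ballot (2 + b) h + ballot (suc b) (2 + h) +_) (pascal N′ b) ⟨
  ballot (2 + b) h + ballot (suc b) (2 + h) + (N′ C b + N′ C suc b)
    ≡⟨ +-rearrange (ballot (2 + b) h) _ _ _ ⟩
  (ballot (2 + b) h + N′ C suc b) + (ballot (suc b) (2 + h) + N′ C b)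
    ≡⟨ cong₂ _+_ (ballot-binomial (suc b) h) binomial′ ⟩
  N′ C (2 + b) + N′ C suc b
    ≡⟨ +-comm (N′ C (2 + b)) _ ⟩
  N′ C suc b + N′ C (2 + b)
    ≡⟨ pascal N′ (suc b) ⟩
  suc N′ C (2 + b)
    ≡⟨ cong (_C (2 + b)) N≡ ⟨
  N C (2 + b) ∎
  where
  open ≡-Reasoning
  N N′ : ℕ
  N  = 2 * suc (suc b) + suc h
  N′ = 2 * suc (suc b) + h
  N≡ : N ≡ suc N′
  N≡ = +-suc (2 * suc (suc b)) h
  binomial′ : ballot (suc b) (2 + h) + N′ C b ≡ N′ C suc b
  binomial′ = subst (λ n → ballot (suc b) (2 + h) + n C b ≡ n C suc b) (lemma b h) (ballot-binomial b (2 + h))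
    where lemma : ∀ b h → 2 * suc b + (2 + h) ≡ 2 * suc (suc b) + h
          lemma = solve-∀
  +-rearrange : ∀ w x y z → w + x + (y + z) ≡ (w + z) + (x + y)
  +-rearrange = solve-∀

C-absorption : ∀ n k → suc k * (suc n C suc k) ≡ suc n * (n C k)
C-absorption zero    zero    = refl
C-absorption zero    (suc k) = *-zeroʳ (2 + k)
C-absorption (suc n) zero    = trans (+-identityʳ _) (trans (nC1≡n (2 + n)) (sym (*-identityʳ (2 + n))))
C-absorption (suc n) (suc k) = begin
  (2 + k) * ((2 + n) C (2 + k))
    ≡⟨ cong ((2 + k) *_) (pascal (suc n) (suc k)) ⟨
  (2 + k) * ((1 + n) C (1 + k) + (1 + n) C (2 + k))
    ≡⟨ *-distribˡ-+ (2 + k) ((1 + n) C (1 + k)) ((1 + n) C (2 + k)) ⟩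
  (1 + n) C (1 + k) + (1 + k) * ((1 + n) C (1 + k)) + (2 + k) * ((1 + n) C (2 + k))
    ≡⟨ cong₂ (λ x y → (1 + n) C (1 + k) + x + y) (C-absorption n k) (C-absorption n (suc k)) ⟩
  (1 + n) C (1 + k) + (1 + n) * (n C k) + (1 + n) * (n C (1 + k))
    ≡⟨ +-assoc ((1 + n) C (1 + k)) ((1 + n) * (n C k)) ((1 + n) * (n C (1 + k))) ⟩
  (1 + n) C (1 + k) + ((1 + n) * (n C k) + (1 + n) * (n C (1 + k)))
    ≡⟨ cong ((1 + n) C (1 + k) +_) (*-distribˡ-+ (1 + n) (n C k) (n C (1 + k))) ⟨
  (1 + n) C (1 + k) + (1 + n) * (n C k + n C (1 + k))
    ≡⟨ cong (λ x → (1 + n) C (1 + k) + (1 + n) * x) (pascal n k) ⟩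
  (2 + n) * ((1 + n) C (1 + k)) ∎
  where open ≡-Reasoning

middle-absorption : ∀ m → (2 + m) * ((2 * suc m) C m) ≡ suc m * ((2 * suc m) C suc m)
middle-absorption m = begin
  (2 + m) * ((2 * suc m) C m)
    ≡⟨ cong (λ n → (2 + m) * (n C m)) N≡ ⟩
  (2 + m) * ((m + (2 + m)) C m)
    ≡⟨ cong ((2 + m) *_) (C-sym m (2 + m)) ⟩
  (2 + m) * ((m + (2 + m)) C (2 + m))
    ≡⟨ cong (λ n → (2 + m) * (n C (2 + m))) N≡′ ⟩
  (2 + m) * (suc t C (2 + m))
    ≡⟨ C-absorption t (suc m) ⟩
  suc t * (t C suc m)
    ≡⟨ cong (suc t *_) (C-sym (suc m) m) ⟩
  suc t * (t C m)
    ≡⟨ C-absorption t m ⟨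
  suc m * (suc t C suc m)
    ≡⟨ cong (λ n → suc m * (n C suc m)) (trans N≡ N≡′) ⟨
  suc m * ((2 * suc m) C suc m) ∎
  where
  open ≡-Reasoning
  t : ℕ
  t = suc m + m
  N≡ : 2 * suc m ≡ m + (2 + m)
  N≡ = lemma m
    where lemma : ∀ m → 2 * suc m ≡ m + (2 + m)
          lemma = solve-∀
  N≡′ : m + (2 + m) ≡ suc t
  N≡′ = lemma m
    where lemma : ∀ m → m + (2 + m) ≡ 2 + (m + m)
          lemma = solve-∀

central-binomial≡ballot : ∀ m → (2 * m) C m ≡ suc m * ballot m 0
central-binomial≡ballot zero    = refl
central-binomial≡ballot (suc m) = sym (+-cancelʳ-≡ (suc m * Y) _ _ (begin
  (2 + m) * c + suc m * Y      ≡⟨ cong ((2 + m) * c +_) (middle-absorption m) ⟨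
  (2 + m) * c + (2 + m) * X    ≡⟨ *-distribˡ-+ (2 + m) c X ⟨
  (2 + m) * (c + X)            ≡⟨ cong ((2 + m) *_) binomial ⟩
  (2 + m) * Y                  ∎))
  where
  open ≡-Reasoning
  c X Y : ℕ
  c = ballot (suc m) 0
  X = (2 * suc m) C m
  Y = (2 * suc m) C suc m
  binomial : c + X ≡ Y
  binomial = subst (λ n → c + n C m ≡ n C suc m) (+-identityʳ (2 * suc m)) (ballot-binomial m 0)

catalan≡ballot : ∀ m → catalan m ≡ ballot m 0
catalan≡ballot m = begin
  ((2 * m) C m) / suc m        ≡⟨ cong (_/ suc m) (central-binomial≡ballot m) ⟩
  suc m * ballot m 0 / suc m   ≡⟨ cong (_/ suc m) (*-comm (suc m) (ballot m 0)) ⟩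
  ballot m 0 * suc m / suc m   ≡⟨ m*n/n≡m (ballot m 0) (suc m) ⟩
  ballot m 0                   ∎
  where open ≡-Reasoning

catalan-suc : ∀ m → catalan (suc m) ≡ splitSum (λ i j → catalan i * catalan j) m
catalan-suc m = begin
  catalan (suc m)                               ≡⟨ catalan≡ballot (suc m) ⟩
  ballot m 1                                    ≡⟨ ballot-convolution m 0 ⟩
  splitSum (λ i j → ballot i 0 * ballot j 0) m
    ≡⟨ splitSum-cong (λ i j → cong₂ _*_ (catalan≡ballot i) (catalan≡ballot j)) m ⟨
  splitSum (λ i j → catalan i * catalan j) m    ∎
  where open ≡-Reasoning

-- Enumerations

record Enumeration {A : Set} (P : A → Set) (n : ℕ) : Set where
  field
    elements : List A
    unique   : Unique elements
    ∈⇔       : ∀ x → x ∈ elements ⇔ P x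
    length≡  : length elements ≡ n

open Enumeration

enumeration-resp : (∀ x → P x ⇔ Q x) → Enumeration P n → Enumeration Q n
enumeration-resp {P = P} {Q = Q} P⇔Q e = record
  { elements = elements e
  ; unique   = unique e
  ; ∈⇔       = λ x → mk⇔ (to (P⇔Q x) ∘ to (∈⇔ e x)) (from (∈⇔ e x) ∘ from (P⇔Q x))
  ; length≡  = length≡ e
  }

singleton : (x : A) → Enumeration (_≡ x) 1
singleton x = record
  { elements = x ∷ []
  ; unique   = All.[] ∷ []
  ; ∈⇔       = λ y → mk⇔ (λ { (here y≡x) → y≡x ; (there ()) }) (λ y≡x → here y≡x)
  ; length≡  = refl
  }

empty : (∀ x → ¬ P x) → Enumeration P 0
empty ¬P = record
  { elements = []
  ; unique   = []
  ; ∈⇔       = λ x → mk⇔ (λ ()) (λ px → ⊥-elim (¬P x px))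
  ; length≡  = refl
  }

union : Enumeration P m → Enumeration Q n → (∀ {x} → P x → Q x → ⊥) →
        Enumeration (λ x → P x ⊎ Q x) (m + n)
union {P = P} {Q = Q} e f disjoint = record
  { elements = elements e ++ elements f
  ; unique   = Uniqueₚ.++⁺ (unique e) (unique f)
                 (λ (x∈e , x∈f) → disjoint (to (∈⇔ e _) x∈e) (to (∈⇔ f _) x∈f))
  ; ∈⇔       = λ x → mk⇔ (to′ x) (from′ x)
  ; length≡  = trans (length-++ (elements e)) (cong₂ _+_ (length≡ e) (length≡ f))
  }
  where
  to′ : ∀ x → x ∈ elements e ++ elements f → P x ⊎ Q x
  to′ x x∈ with ∈-++⁻ (elements e) x∈
  ... | inj₁ x∈e = inj₁ (to (∈⇔ e x) x∈e)
  ... | inj₂ x∈f = inj₂ (to (∈⇔ f x) x∈f)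
  from′ : ∀ x → P x ⊎ Q x → x ∈ elements e ++ elements f
  from′ x (inj₁ px) = ∈-++⁺ˡ (from (∈⇔ e x) px)
  from′ x (inj₂ qx) = ∈-++⁺ʳ (elements e) (from (∈⇔ f x) qx)

length-cartesianProduct : (xs : List A) (ys : List B) →
                          length (cartesianProduct xs ys) ≡ length xs * length ys
length-cartesianProduct []       ys = refl
length-cartesianProduct (x ∷ xs) ys = begin
  length (map (x ,_) ys ++ cartesianProduct xs ys)
    ≡⟨ length-++ (map (x ,_) ys) ⟩
  length (map (x ,_) ys) + length (cartesianProduct xs ys)
    ≡⟨ cong₂ _+_ (length-map (x ,_) ys) (length-cartesianProduct xs ys) ⟩
  length ys + length xs * length ys ∎
  where open ≡-Reasoning

product : Enumeration P m → Enumeration Q n → Enumeration (λ (x , y) → P x × Q y) (m * n)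
product e f = record
  { elements = cartesianProduct (elements e) (elements f)
  ; unique   = Uniqueₚ.cartesianProduct⁺ (unique e) (unique f)
  ; ∈⇔       = λ (x , y) → mk⇔
      (λ xy∈ → let x∈ , y∈ = ∈-cartesianProduct⁻ (elements e) (elements f) xy∈
               in to (∈⇔ e x) x∈ , to (∈⇔ f y) y∈)
      (λ (px , qy) → ∈-cartesianProduct⁺ (from (∈⇔ e x) px) (from (∈⇔ f y) qy))
  ; length≡  = trans (length-cartesianProduct (elements e) (elements f)) (cong₂ _*_ (length≡ e) (length≡ f))
  }

Unique-map⁺ : ∀ {f : A → B} {xs} → (∀ {x y} → x ∈ xs → y ∈ xs → f x ≡ f y → x ≡ y) →
              Unique xs → Unique (map f xs)
Unique-map⁺ inj []           = []
Unique-map⁺ inj (x∉xs ∷ xs!) =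
  Allₚ.map⁺ (All.tabulate λ y∈xs fx≡fy → All.lookup x∉xs y∈xs (inj (here refl) (there y∈xs) fx≡fy))
  ∷ Unique-map⁺ (λ x∈ y∈ → inj (there x∈) (there y∈)) xs!

image : (f : A → B) → (∀ {x y} → P x → P y → f x ≡ f y → x ≡ y) → Enumeration P n →
        Enumeration (λ y → ∃[ x ] P x × y ≡ f x) n
image f inj e = record
  { elements = map f (elements e)
  ; unique   = Unique-map⁺ (λ x∈ y∈ → inj (to (∈⇔ e _) x∈) (to (∈⇔ e _) y∈)) (unique e)
  ; ∈⇔       = λ y → mk⇔
      (λ y∈ → let x , x∈ , y≡fx = ∈-map⁻ f y∈ in x , to (∈⇔ e x) x∈ , y≡fx)
      (λ { (x , px , refl) → ∈-map⁺ f (from (∈⇔ e x) px) })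
  ; length≡  = trans (length-map f (elements e)) (length≡ e)
  }

splitUnion : ∀ {P : ℕ → ℕ → A → Set} {c : ℕ → ℕ → ℕ} n →
  (∀ i j → i + j ≡ n → Enumeration (P i j) (c i j)) →
  (∀ {i j i′ j′ x} → i + j ≡ n → i′ + j′ ≡ n → P i j x → P i′ j′ x → i ≡ i′) →
  Enumeration (λ x → ∃[ i ] ∃[ j ] i + j ≡ n × P i j x) (splitSum c n)
splitUnion {P = P} zero e disjoint = enumeration-resp (λ x → mk⇔ (λ p → 0 , 0 , refl , p) to′) (e 0 0 refl)
  where
  to′ : ∀ {x} → ∃[ i ] ∃[ j ] i + j ≡ 0 × P i j x → P 0 0 x
  to′ (zero , zero , refl , p) = p
splitUnion {P = P} (suc n) e disjoint = enumeration-resp (λ x → mk⇔ to′ from′)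
  (union (e 0 (suc n) refl)
         (splitUnion n (λ i j i+j≡n → e (suc i) j (cong suc i+j≡n))
            (λ i+j≡n i′+j′≡n p p′ → suc-injective (disjoint (cong suc i+j≡n) (cong suc i′+j′≡n) p p′)))
         (λ { p (i , j , i+j≡n , p′) → 0≢1+n (disjoint refl (cong suc i+j≡n) p p′) }))
  where
  to′ : ∀ {x} → P 0 (suc n) x ⊎ (∃[ i ] ∃[ j ] i + j ≡ n × P (suc i) j x) →
        ∃[ i ] ∃[ j ] i + j ≡ suc n × P i j x
  to′ (inj₁ p)                  = 0 , suc n , refl , p
  to′ (inj₂ (i , j , refl , p)) = suc i , j , refl , p
  from′ : ∀ {x} → ∃[ i ] ∃[ j ] i + j ≡ suc n × P i j x →
          P 0 (suc n) x ⊎ (∃[ i ] ∃[ j ] i + j ≡ n × P (suc i) j x)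
  from′ (zero  , j , refl , p)     = inj₁ p
  from′ (suc i , j , i+j≡1+n , p) = inj₂ (i , j , suc-injective i+j≡1+n , p)

Glued : A → (List A → Set) → (List A → Set) → List A → Set
Glued x P Q zs = ∃[ xs ] ∃[ ys ] P xs × Q ys × zs ≡ xs ++ x ∷ ys

++-∷-cancel : ∀ {x : A} xs xs′ {ys ys′} → x ∉ xs → x ∉ xs′ →
              xs ++ x ∷ ys ≡ xs′ ++ x ∷ ys′ → xs ≡ xs′ × ys ≡ ys′
++-∷-cancel []       []         x∉ x∉′ refl = refl , refl
++-∷-cancel []       (_ ∷ _)    x∉ x∉′ refl = ⊥-elim (x∉′ (here refl))
++-∷-cancel (_ ∷ _)  []         x∉ x∉′ refl = ⊥-elim (x∉ (here refl))
++-∷-cancel (z ∷ xs) (z′ ∷ xs′) x∉ x∉′ eq with refl ← ∷-injectiveˡ eq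
  with refl , refl ← ++-∷-cancel xs xs′ (x∉ ∘ there) (x∉′ ∘ there) (∷-injectiveʳ eq) = refl , refl

glue : (x : A) {P Q : List A → Set} → Enumeration P m → Enumeration Q n → (∀ {xs} → P xs → x ∉ xs) →
       Enumeration (Glued x P Q) (m * n)
glue x {P} {Q} e f x∉ = enumeration-resp reshape (image (λ (xs , ys) → xs ++ x ∷ ys) injective (product e f))
  where
  injective : ∀ {(xs , ys) (xs′ , ys′) : List _ × List _} → P xs × Q ys → P xs′ × Q ys′ →
              xs ++ x ∷ ys ≡ xs′ ++ x ∷ ys′ → (xs , ys) ≡ (xs′ , ys′)
  injective {xs , _} {xs′ , _} (p , _) (p′ , _) eq
    with refl , refl ← ++-∷-cancel xs xs′ (x∉ p) (x∉ p′) eq = refl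
  reshape : ∀ zs → (∃[ (xs , ys) ] (P xs × Q ys) × zs ≡ xs ++ x ∷ ys) ⇔ Glued x P Q zs
  reshape zs = mk⇔ (λ ((xs , ys) , (p , q) , eq) → xs , ys , p , q , eq)
                   (λ (xs , ys , p , q , eq) → (xs , ys) , (p , q) , eq)

-- 132-avoiding permutations of an interval

range : ℕ → ℕ → List ℕ
range o zero    = []
range o (suc n) = suc o ∷ range (suc o) n

∈-range⁻ : ∀ {x} o n → x ∈ range o n → o < x × x ≤ o + n
∈-range⁻ o (suc n) (here refl) = ≤-refl , ≤-trans (s≤s (m≤m+n o n)) (≤-reflexive (sym (+-suc o n)))
∈-range⁻ o (suc n) (there x∈)  with o<x , x≤ ← ∈-range⁻ (suc o) n x∈ =
  <⇒≤ o<x , ≤-trans x≤ (≤-reflexive (sym (+-suc o n)))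

length-range : ∀ o n → length (range o n) ≡ n
length-range o zero    = refl
length-range o (suc n) = cong suc (length-range (suc o) n)

range-++ : ∀ o j k → range o (j + k) ≡ range o j ++ range (o + j) k
range-++ o zero    k = cong (λ o′ → range o′ k) (sym (+-identityʳ o))
range-++ o (suc j) k = cong (suc o ∷_)
  (trans (range-++ (suc o) j k) (cong (λ o′ → range (suc o) j ++ range o′ k) (sym (+-suc o j))))

range-suc : ∀ o n → range o (suc n) ≡ range o n ++ [ suc (o + n) ]
range-suc o n = trans (cong (range o) (+-comm 1 n)) (range-++ o n 1)

∈-range-last : ∀ o n → suc (o + n) ∈ range o (suc n)
∈-range-last o n = subst (suc (o + n) ∈_) (sym (range-suc o n)) (∈-++⁺ʳ (range o n) (here refl))

Unique-range : ∀ o n → Unique (range o n)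
Unique-range o zero    = []
Unique-range o (suc n) =
  All.tabulate (λ x∈ → <⇒≢ (proj₁ (∈-range⁻ (suc o) n x∈))) ∷ Unique-range (suc o) n

oneTo≡range : ∀ n → oneTo n ≡ range 0 n
oneTo≡range n = trans (map-upTo suc n) (applyUpTo≡range 0 n suc (λ _ → refl))
  where
  applyUpTo≡range : ∀ o n f → (∀ i → f i ≡ suc (o + i)) → applyUpTo f n ≡ range o n
  applyUpTo≡range o zero    f f≗ = refl
  applyUpTo≡range o (suc n) f f≗ = cong₂ _∷_ (trans (f≗ 0) (cong suc (+-identityʳ o)))
    (applyUpTo≡range (suc o) n (f ∘ suc) (λ i → trans (f≗ (suc i)) (cong suc (+-suc o i))))

↭-range-< : ∀ {xs} o n {M} → xs ↭ range o n → o + n < M → All (_< M) xs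
↭-range-< o n xs↭ o+n<M =
  All.tabulate λ x∈ → ≤-<-trans (proj₂ (∈-range⁻ o n (∈-resp-↭ xs↭ x∈))) o+n<M

upper-<-max : ∀ o {j k n α} → j + k ≡ n → α ↭ range (o + j) k → All (_< suc (o + n)) α
upper-<-max o {j} {k} refl α↭ = ↭-range-< (o + j) k α↭ (s≤s (≤-reflexive (+-assoc o j k)))

lower-<-max : ∀ o {j k n β} → j + k ≡ n → β ↭ range o j → All (_< suc (o + n)) β
lower-<-max o {j} {k} refl β↭ = ↭-range-< o j β↭ (s≤s (+-monoʳ-≤ o (m≤m+n j k)))

↭-range-∉ : ∀ {xs} o n {M} → xs ↭ range o n → o + n < M → M ∉ xs
↭-range-∉ o n xs↭ o+n<M M∈ = <-irrefl refl (All.lookup (↭-range-< o n xs↭ o+n<M) M∈)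

filter-all-++-none : (P? : Decidable P) {xs ys : List A} → All P xs → All (¬_ ∘ P) ys →
                     filter P? (xs ++ ys) ≡ xs
filter-all-++-none P? {xs} {ys} all none = begin
  filter P? (xs ++ ys)            ≡⟨ filter-++ P? xs ys ⟩
  filter P? xs ++ filter P? ys    ≡⟨ cong₂ _++_ (filter-all P? all) (filter-none P? none) ⟩
  xs ++ []                        ≡⟨ ++-identityʳ xs ⟩
  xs                              ∎
  where open ≡-Reasoning

filter-none-++-all : (P? : Decidable P) {xs ys : List A} → All (¬_ ∘ P) xs → All P ys →
                     filter P? (xs ++ ys) ≡ ys
filter-none-++-all P? {xs} {ys} none all =
  trans (filter-++ P? xs ys) (cong₂ _++_ (filter-none P? none) (filter-all P? all))

range-split : ∀ o n {α β} → α ++ β ↭ range o n → (∀ {a c} → a ∈ α → c ∈ β → c < a) →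
  ∃[ j ] ∃[ k ] j + k ≡ n × α ↭ range (o + j) k × β ↭ range o j
range-split o n {α} {β} α++β↭ β<α = j , k , j+k≡n , α↭ , β↭
  where
  bounds : ∀ {x} → x ∈ α ++ β → o < x × x ≤ o + n
  bounds x∈ = ∈-range⁻ o n (∈-resp-↭ α++β↭ x∈)
  t : ℕ
  t = max o β
  o≤t : o ≤ t
  o≤t = ⊥≤max o β
  t<α : All (t <_) α
  t<α = All.tabulate λ a∈ → max<v⁺ (proj₁ (bounds (∈-++⁺ˡ a∈))) (All.tabulate (β<α a∈))
  t≤o+n : t ≤ o + n
  t≤o+n = max≤v⁺ (m≤m+n o n) (All.tabulate λ c∈ → proj₂ (bounds (∈-++⁺ʳ α c∈)))
  j k : ℕ
  j = t ∸ o
  k = o + n ∸ t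
  o+j≡t : o + j ≡ t
  o+j≡t = m+[n∸m]≡n o≤t
  j+k≡n : j + k ≡ n
  j+k≡n = +-cancelˡ-≡ o (j + k) n (begin
    o + (j + k)  ≡⟨ +-assoc o j k ⟨
    o + j + k    ≡⟨ cong (_+ k) o+j≡t ⟩
    t + k        ≡⟨ m+[n∸m]≡n t≤o+n ⟩
    o + n        ∎)
    where open ≡-Reasoning
  range≡ : range o n ≡ range o j ++ range (o + j) k
  range≡ = trans (cong (range o) (sym j+k≡n)) (range-++ o j k)
  lower : All (_≤ t) (range o j)
  lower = All.tabulate λ x∈ → subst (_ ≤_) o+j≡t (proj₂ (∈-range⁻ o j x∈))
  upper : All (t <_) (range (o + j) k)
  upper = All.tabulate λ x∈ → subst (_< _) o+j≡t (proj₁ (∈-range⁻ (o + j) k x∈))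
  β↭ : β ↭ range o j
  β↭ = subst₂ _↭_ (filter-none-++-all (_≤? t) (All.map <⇒≱ t<α) (xs≤max o β))
    (trans (cong (filter (_≤? t)) range≡) (filter-all-++-none (_≤? t) lower (All.map <⇒≱ upper)))
    (filter-↭ (_≤? t) α++β↭)
  α↭ : α ↭ range (o + j) k
  α↭ = subst₂ _↭_ (filter-all-++-none (t <?_) t<α (All.map ≤⇒≯ (xs≤max o β)))
    (trans (cong (filter (t <?_)) range≡) (filter-none-++-all (t <?_) (All.map ≤⇒≯ lower) upper))
    (filter-↭ (t <?_) α++β↭)

Unique-++-disjoint : ∀ (xs : List A) {ys x y} → Unique (xs ++ ys) → x ∈ xs → y ∈ ys → x ≢ y
Unique-++-disjoint (_ ∷ xs) (x∉ ∷ _)  (here refl) y∈ = All.lookup x∉ (∈-++⁺ʳ xs y∈)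
Unique-++-disjoint (_ ∷ xs) (_  ∷ xs!) (there x∈) y∈ = Unique-++-disjoint xs xs! x∈ y∈

⊆-++⁻ : ∀ (xs : List A) {ys zs} → zs ⊆ xs ++ ys →
        ∃[ zs₁ ] ∃[ zs₂ ] zs ≡ zs₁ ++ zs₂ × zs₁ ⊆ xs × zs₂ ⊆ ys
⊆-++⁻ []       zs⊆             = [] , _ , refl , [] , zs⊆
⊆-++⁻ (x ∷ xs) (.x Sublist.∷ʳ zs⊆) with zs₁ , zs₂ , refl , zs₁⊆ , zs₂⊆ ← ⊆-++⁻ xs zs⊆ =
  zs₁ , zs₂ , refl , x Sublist.∷ʳ zs₁⊆ , zs₂⊆
⊆-++⁻ (x ∷ xs) (refl ∷ zs⊆)    with zs₁ , zs₂ , refl , zs₁⊆ , zs₂⊆ ← ⊆-++⁻ xs zs⊆ =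
  x ∷ zs₁ , zs₂ , refl , refl ∷ zs₁⊆ , zs₂⊆

Avoids132-⊆ : ∀ {xs ys} → xs ⊆ ys → Avoids132 ys → Avoids132 xs
Avoids132-⊆ xs⊆ys av a b c abc⊆ = av a b c (⊆-trans abc⊆ xs⊆ys)

-- 132 is skew-indecomposable, so a skew sum of 132-avoiders avoids 132.
Avoids132-skew : ∀ {xs ys} → Avoids132 xs → Avoids132 ys → (∀ {x y} → x ∈ xs → y ∈ ys → y < x) →
                 Avoids132 (xs ++ ys)
Avoids132-skew {xs} avx avy y<x a b c abc⊆ a<c<b@(a<c , _) with ⊆-++⁻ xs abc⊆
... | []                , _     , refl , _    , abc⊆ys = avy a b c abc⊆ys a<c<b
... | _ ∷ []            , _     , refl , a⊆xs , bc⊆ys = <-asym a<c (y<x (to∈ a⊆xs) (to∈ (⊆.∷ˡ⁻ bc⊆ys)))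
... | _ ∷ _ ∷ []        , _     , refl , ab⊆  , c⊆ys  = <-asym a<c (y<x (to∈ ab⊆) (to∈ c⊆ys))
... | _ ∷ _ ∷ _ ∷ []    , []    , refl , abc⊆xs , _   = avx a b c abc⊆xs a<c<b
... | _ ∷ _ ∷ _ ∷ []    , _ ∷ _ , ()   , _ , _
... | _ ∷ _ ∷ _ ∷ _ ∷ _ , _     , ()   , _ , _

Avoids132-++-max : ∀ {xs M} → Avoids132 xs → All (_< M) xs → Avoids132 (xs ++ [ M ])
Avoids132-++-max {xs} avx xs<M a b c abc⊆ a<c<b@(_ , c<b) with ⊆-++⁻ xs abc⊆
... | _ ∷ _ ∷ _ ∷ []    , []    , refl , abc⊆xs , _  = avx a b c abc⊆xs a<c<b
... | _ ∷ _ ∷ []        , _     , refl , ab⊆xs , c⊆M with here refl ← to∈ c⊆M =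
  <-asym c<b (All.lookup xs<M (to∈ (⊆.∷ˡ⁻ ab⊆xs)))
... | _ ∷ []            , _     , refl , _ , bc⊆M  = <-irrefl refl (⊆.length-mono-≤ bc⊆M)
... | []                , _     , refl , _ , abc⊆M = <-irrefl refl (<-≤-trans (s≤s (s≤s z≤n)) (⊆.length-mono-≤ abc⊆M))
... | _ ∷ _ ∷ _ ∷ []    , _ ∷ _ , ()   , _ , _
... | _ ∷ _ ∷ _ ∷ _ ∷ _ , _     , ()   , _ , _

Perm132 : ℕ → ℕ → List ℕ → Set
Perm132 o n π = π ↭ range o n × Avoids132 π

Perm132-length : ∀ {o n π} → Perm132 o n π → length π ≡ n
Perm132-length {o} {n} (π↭ , _) = trans (↭-length π↭) (length-range o n)

Perm132-split : ∀ o n {π} → Perm132 o (suc n) π →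
  ∃[ j ] ∃[ k ] j + k ≡ n × Glued (suc (o + n)) (Perm132 (o + j) k) (Perm132 o j) π
Perm132-split o n {π} (π↭ , av)
  with α , β , refl ← ∈-∃++ (∈-resp-↭ (↭-sym π↭) (∈-range-last o n)) =
  let j , k , j+k≡n , α↭ , β↭ = range-split o n α++β↭ β<α in
  j , k , j+k≡n , α , β , (α↭ , Avoids132-⊆ (⊆.++⁺ʳ (M ∷ β) ⊆-refl) av)
                        , (β↭ , Avoids132-⊆ (⊆.++⁺ˡ α (M Sublist.∷ʳ ⊆-refl)) av) , refl
  where
  M = suc (o + n)
  π↭′ : α ++ M ∷ β ↭ range o n ++ [ M ]
  π↭′ = subst (α ++ M ∷ β ↭_) (range-suc o n) π↭
  α++β↭ : α ++ β ↭ range o n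
  α++β↭ = ↭-trans (drop-mid α (range o n) π↭′) (↭-reflexive (++-identityʳ (range o n)))
  β<M : ∀ {c} → c ∈ β → c < M
  β<M c∈ = s≤s (proj₂ (∈-range⁻ o n (∈-resp-↭ α++β↭ (∈-++⁺ʳ α c∈))))
  α++β! : Unique (α ++ β)
  α++β! = ↭ₛ.Unique-resp-↭ (setoid ℕ) (↭⇒↭ₛ (↭-sym α++β↭)) (Unique-range o n)
  β<α : ∀ {a c} → a ∈ α → c ∈ β → c < a
  β<α a∈ c∈ = ≤∧≢⇒< (≮⇒≥ λ a<c → av _ M _ (⊆.++⁺ (from∈ a∈) (refl ∷ from∈ c∈)) (a<c , β<M c∈))
                    (≢-sym (Unique-++-disjoint α α++β! a∈ c∈))

Perm132-glue : ∀ o {j k n α β} → j + k ≡ n → Perm132 (o + j) k α → Perm132 o j β →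
               Perm132 o (suc n) (α ++ suc (o + n) ∷ β)
Perm132-glue o {j} {k} {n} {α} {β} refl (α↭ , avα) (β↭ , avβ) = π↭ , av
  where
  M = suc (o + n)
  π↭ : α ++ M ∷ β ↭ range o (suc n)
  π↭ = begin
    α ++ M ∷ β                     ↭⟨ ++-comm α (M ∷ β) ⟩
    M ∷ β ++ α                     ↭⟨ prep M (++⁺ β↭ α↭) ⟩
    M ∷ range o j ++ range (o + j) k ≡⟨ cong (M ∷_) (range-++ o j k) ⟨
    M ∷ range o n                  ↭⟨ ∷↭∷ʳ M (range o n) ⟩
    range o n ++ [ M ]             ≡⟨ range-suc o n ⟨
    range o (suc n)                ∎
    where open PermutationReasoning
  below : ∀ {x} → x ∈ α ++ [ M ] → o + j < x
  below x∈ with ∈-++⁻ α x∈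
  ... | inj₁ x∈α         = proj₁ (∈-range⁻ (o + j) k (∈-resp-↭ α↭ x∈α))
  ... | inj₂ (here refl) = s≤s (+-monoʳ-≤ o (m≤m+n j k))
  av : Avoids132 (α ++ M ∷ β)
  av = subst Avoids132 (++-assoc α [ M ] β)
    (Avoids132-skew (Avoids132-++-max avα (upper-<-max o refl α↭)) avβ
      λ x∈ y∈ → ≤-<-trans (proj₂ (∈-range⁻ o j (∈-resp-↭ β↭ y∈))) (below x∈))

-- Parity and Dumont permutations

Even-2* : ∀ q → Even (2 * q)
Even-2* q = trans (cong (_% 2) (*-comm 2 q)) (m*n%n≡0 q 2)

Odd-1+2* : ∀ q → Odd (suc (2 * q))
Odd-1+2* q = trans (cong (λ n → suc n % 2) (*-comm 2 q)) ([m+kn]%n≡m%n 1 q 2)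

Odd⇒¬Even : ∀ {n} → Odd n → ¬ Even n
Odd⇒¬Even odd even with () ← trans (sym even) odd

Even⇒¬Even-suc : ∀ {n} → Even n → ¬ Even (suc n)
Even⇒¬Even-suc {n} even-n = Odd⇒¬Even {suc n} (trans (%-distribˡ-+ 1 n 2) (cong (λ r → (1 + r) % 2) even-n))

even-or-odd : ∀ n → ∃[ q ] (n ≡ 2 * q ⊎ n ≡ suc (2 * q))
even-or-odd zero    = 0 , inj₁ refl
even-or-odd (suc n) with even-or-odd n
... | q , inj₁ refl = q , inj₂ refl
... | q , inj₂ refl = suc q , inj₁ (sym (cong suc (+-suc q (q + 0))))

even? : Decidable Even
even? n = n % 2 ≟ 0

Dumont-++-∷ : ∀ α {M β} → All (_< M) α → Dumont (α ++ M ∷ β) ⇔ (Dumont α × Dumont (M ∷ β))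
Dumont-++-∷ α α<M = mk⇔ (split α α<M) (uncurry (join α α<M))
  where
  split : ∀ α {M β} → All (_< M) α → Dumont (α ++ M ∷ β) → Dumont α × Dumont (M ∷ β)
  split []          _               d                        = tt , d
  split (a ∷ [])    (a<M ∷ [])      (inj₁ (_ , M<a) , _)     = contradiction M<a (<⇒≯ a<M)
  split (a ∷ [])    (a<M ∷ [])      (inj₂ (odd-a , _) , d)   = odd-a , d
  split (a ∷ b ∷ α) (_ ∷ b∷α<M)     (step , d)               =
    let dα , dM = split (b ∷ α) b∷α<M d in (step , dα) , dM
  join : ∀ α {M β} → All (_< M) α → Dumont α → Dumont (M ∷ β) → Dumont (α ++ M ∷ β)
  join []          _           _           dM = dM
  join (a ∷ [])    (a<M ∷ [])  odd-a       dM = inj₂ (odd-a , a<M) , dM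
  join (a ∷ b ∷ α) (_ ∷ b∷α<M) (step , dα) dM = step , join (b ∷ α) b∷α<M dα dM

Dumont-∷ : ∀ {M β} → All (_< M) β →
           Dumont (M ∷ β) ⇔ (Odd M × β ≡ [] ⊎ Even M × β ≢ [] × Dumont β)
Dumont-∷ {M} {β} β<M = mk⇔ (to′ β β<M) (from′ β β<M)
  where
  to′ : ∀ β → All (_< M) β → Dumont (M ∷ β) → Odd M × β ≡ [] ⊎ Even M × β ≢ [] × Dumont β
  to′ []      _         odd-M                     = inj₁ (odd-M , refl)
  to′ (b ∷ β) _         (inj₁ (even-M , _) , d)  = inj₂ (even-M , (λ ()) , d)
  to′ (b ∷ β) (b<M ∷ _) (inj₂ (_ , M<b) , _)      = contradiction M<b (<⇒≯ b<M)
  from′ : ∀ β → All (_< M) β → Odd M × β ≡ [] ⊎ Even M × β ≢ [] × Dumont β → Dumont (M ∷ β)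
  from′ []      _         (inj₁ (odd-M , _))       = odd-M
  from′ []      _         (inj₂ (_ , []≢[] , _))   = contradiction refl []≢[]
  from′ (b ∷ β) _         (inj₁ (_ , ()))
  from′ (b ∷ β) (b<M ∷ _) (inj₂ (even-M , _ , d)) = inj₁ (even-M , b<M) , d

Dumont-min : ∀ {x} π → Dumont π → x ∈ π → All (x ≤_) π → Odd x
Dumont-min (a ∷ [])    d                      (here refl) _             = d
Dumont-min (a ∷ b ∷ π) (inj₁ (_ , b<a) , _)   (here refl) (_ ∷ a≤b ∷ _) = contradiction b<a (≤⇒≯ a≤b)
Dumont-min (a ∷ b ∷ π) (inj₂ (odd-a , _) , _) (here refl) _             = odd-a
Dumont-min (a ∷ b ∷ π) (_ , d)                (there x∈)  (_ ∷ x≤π)     = Dumont-min (b ∷ π) d x∈ x≤π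

Dumont-range-min : ∀ {α} o k → α ↭ range o (suc k) → Dumont α → Odd (suc o)
Dumont-range-min {α} o k α↭ dα = Dumont-min α dα (∈-resp-↭ (↭-sym α↭) (here refl))
  (All.tabulate λ x∈ → proj₁ (∈-range⁻ o (suc k) (∈-resp-↭ α↭ x∈)))

descents≡evens : ∀ π → Dumont π → descents π ≡ length (filter even? π)
descents≡evens []          _ = refl
descents≡evens (a ∷ [])    odd-a =
  cong length (sym (filter-reject even? {x = a} {xs = []} (Odd⇒¬Even {a} odd-a)))
descents≡evens (a ∷ b ∷ π) (inj₁ (even-a , b<a) , d) = begin
  (if b <ᵇ a then 1 else 0) + descents (b ∷ π)
    ≡⟨ cong (λ t → (if t then 1 else 0) + descents (b ∷ π)) (dec-true (b <? a) b<a) ⟩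
  suc (descents (b ∷ π))
    ≡⟨ cong suc (descents≡evens (b ∷ π) d) ⟩
  suc (length (filter even? (b ∷ π)))
    ≡⟨ cong length (filter-accept even? {x = a} {xs = b ∷ π} even-a) ⟨
  length (filter even? (a ∷ b ∷ π)) ∎
  where open ≡-Reasoning
descents≡evens (a ∷ b ∷ π) (inj₂ (odd-a , a<b) , d) = begin
  (if b <ᵇ a then 1 else 0) + descents (b ∷ π)
    ≡⟨ cong (λ t → (if t then 1 else 0) + descents (b ∷ π)) (dec-false (b <? a) (<⇒≯ a<b)) ⟩
  descents (b ∷ π)
    ≡⟨ descents≡evens (b ∷ π) d ⟩
  length (filter even? (b ∷ π))
    ≡⟨ cong length (filter-reject even? {x = a} {xs = b ∷ π} (Odd⇒¬Even {a} odd-a)) ⟨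
  length (filter even? (a ∷ b ∷ π)) ∎
  where open ≡-Reasoning

-- Decomposing 132-avoiding Dumont permutations

Dumont132 : ℕ → ℕ → List ℕ → Set
Dumont132 o n π = Perm132 o n π × Dumont π

Dumont132-zero : ∀ o π → Dumont132 o 0 π ⇔ π ≡ []
Dumont132-zero o π = mk⇔ (λ ((π↭ , _) , _) → ↭-empty-inv π↭) λ { refl → (↭-refl , λ _ _ _ ()) , tt }

Dumont132-split : ∀ o n {π} → Dumont132 o (suc n) π →
  ∃[ j ] ∃[ k ] j + k ≡ n ×
    Glued (suc (o + n)) (Dumont132 (o + j) k) (λ β → Perm132 o j β × Dumont (suc (o + n) ∷ β)) π
Dumont132-split o n ((π↭ , av) , d) with Perm132-split o n (π↭ , av)
... | j , k , j+k≡n , α , β , pα@(α↭ , _) , pβ , refl =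
  let dα , dMβ = to (Dumont-++-∷ α (upper-<-max o j+k≡n α↭)) d
  in j , k , j+k≡n , α , β , (pα , dα) , (pβ , dMβ) , refl

Dumont132-glue : ∀ o {j k n α β} → j + k ≡ n → Dumont132 (o + j) k α → Perm132 o j β →
                 Dumont (suc (o + n) ∷ β) → Dumont132 o (suc n) (α ++ suc (o + n) ∷ β)
Dumont132-glue o {α = α} refl (pα@(α↭ , _) , dα) pβ dMβ =
  Perm132-glue o refl pα pβ , from (Dumont-++-∷ α (upper-<-max o refl α↭)) (dα , dMβ)

Dumont132-odd : ∀ p m π → Dumont132 (2 * p) (suc (2 * m)) π ⇔
                           Glued (suc (2 * p + 2 * m)) (Dumont132 (2 * p) (2 * m)) (_≡ []) π
Dumont132-odd p m π = mk⇔ to′ from′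
  where
  o = 2 * p
  M = suc (o + 2 * m)
  odd-M : Odd M
  odd-M = subst (λ n → Odd (suc n)) (*-distribˡ-+ 2 p m) (Odd-1+2* (p + m))
  to′ : Dumont132 o (suc (2 * m)) π → Glued M (Dumont132 o (2 * m)) (_≡ []) π
  to′ dπ with Dumont132-split o (2 * m) dπ
  ... | j , k , j+k≡n , α , β , dα , (pβ@(β↭ , _) , dMβ) , refl
    with to (Dumont-∷ (lower-<-max o j+k≡n β↭)) dMβ
  ... | inj₂ (even-M , _) = contradiction even-M (Odd⇒¬Even {M} odd-M)
  ... | inj₁ (_ , refl) with refl ← sym (Perm132-length pβ) =
    α , [] , subst₂ (λ o′ k′ → Dumont132 o′ k′ α) (+-identityʳ o) j+k≡n dα , refl , refl
  from′ : Glued M (Dumont132 o (2 * m)) (_≡ []) π → Dumont132 o (suc (2 * m)) π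
  from′ (α , _ , dα , refl , refl) =
    Dumont132-glue o refl (subst (λ o′ → Dumont132 o′ (2 * m) α) (sym (+-identityʳ o)) dα)
                   (↭-refl , λ _ _ _ ()) odd-M

-- An even-length π = α M β has |β| = lowerSize m s and |α| = upperSize s r for some s + r = m: the
-- minimum of a nonempty α is odd, so β holds all 2m + 1 smaller values (s = 0) or an even number of them.
lowerSize : ℕ → ℕ → ℕ
lowerSize m zero    = suc (2 * m)
lowerSize m (suc s) = 2 * suc s

upperSize : ℕ → ℕ → ℕ
upperSize zero    r = 0
upperSize (suc s) r = suc (2 * r)

lowerSize≢0 : ∀ m s → lowerSize m s ≢ 0
lowerSize≢0 m zero    ()
lowerSize≢0 m (suc s) ()

lowerSize+upperSize : ∀ {m} s r → s + r ≡ m → lowerSize m s + upperSize s r ≡ suc (2 * m)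
lowerSize+upperSize zero    r refl = +-identityʳ (suc (2 * r))
lowerSize+upperSize (suc s) r refl = lemma s r
  where lemma : ∀ s r → 2 * suc s + suc (2 * r) ≡ suc (2 * (suc s + r))
        lemma = solve-∀

upperSize-injective : ∀ {m s r s′ r′} → s + r ≡ m → s′ + r′ ≡ m →
                      upperSize s r ≡ upperSize s′ r′ → s ≡ s′
upperSize-injective {s = zero}  {s′ = zero} _ _ _ = refl
upperSize-injective {s = suc s} {r} {suc s′} {r′} s+r≡m s′+r′≡m eq =
  +-cancelʳ-≡ r (suc s) (suc s′) (begin
    suc s + r    ≡⟨ trans s+r≡m (sym s′+r′≡m) ⟩
    suc s′ + r′  ≡⟨ cong (suc s′ +_) (*-cancelˡ-≡ r r′ 2 (suc-injective eq)) ⟨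
    suc s′ + r   ∎)
  where open ≡-Reasoning

odd-complement : ∀ s k m → 2 * s + k ≡ suc (2 * m) → ∃[ r ] k ≡ suc (2 * r) × s + r ≡ m
odd-complement s k m 2s+k≡ with even-or-odd k
... | r , inj₁ refl = contradiction (trans (*-distribˡ-+ 2 s r) 2s+k≡) (even≢odd (s + r) m)
... | r , inj₂ refl = r , refl , *-cancelˡ-≡ (s + r) m 2 (suc-injective (begin
  suc (2 * (s + r))    ≡⟨ cong suc (*-distribˡ-+ 2 s r) ⟩
  suc (2 * s + 2 * r)  ≡⟨ +-suc (2 * s) (2 * r) ⟨
  2 * s + suc (2 * r)  ≡⟨ 2s+k≡ ⟩
  suc (2 * m)          ∎))
  where open ≡-Reasoning

split-sizes : ∀ p m j k → j + k ≡ suc (2 * m) → j ≢ 0 → (k ≢ 0 → Odd (suc (2 * p + j))) →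
  ∃[ s ] ∃[ r ] s + r ≡ m × j ≡ lowerSize m s × k ≡ upperSize s r
split-sizes p m j zero    j+k≡ _   _       = 0 , m , refl , trans (sym (+-identityʳ j)) j+k≡ , refl
split-sizes p m j (suc k) j+k≡ j≢0 odd-min with even-or-odd j
... | zero  , inj₁ refl = contradiction refl j≢0
... | suc s , inj₁ refl with r , k≡ , s+r≡m ← odd-complement (suc s) (suc k) m j+k≡ =
  suc s , r , s+r≡m , refl , k≡
... | q     , inj₂ refl =
  contradiction (subst Even (sym (lemma p q)) (Even-2* (suc (p + q))))
                (Odd⇒¬Even {suc (2 * p + suc (2 * q))} (odd-min λ ()))
  where lemma : ∀ p q → suc (2 * p + suc (2 * q)) ≡ 2 * suc (p + q)
        lemma = solve-∀

Piece : ℕ → ℕ → ℕ → ℕ → List ℕ → Set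
Piece p m s r = Glued (suc (2 * p + suc (2 * m)))
  (Dumont132 (2 * p + lowerSize m s) (upperSize s r)) (Dumont132 (2 * p) (lowerSize m s))

Dumont132-even : ∀ p m π → Dumont132 (2 * p) (suc (suc (2 * m))) π ⇔
                            (∃[ s ] ∃[ r ] s + r ≡ m × Piece p m s r π)
Dumont132-even p m π = mk⇔ to′ from′
  where
  o = 2 * p
  M = suc (2 * p + suc (2 * m))
  even-M : Even M
  even-M = subst Even (sym (lemma p m)) (Even-2* (p + suc m))
    where lemma : ∀ p m → suc (2 * p + suc (2 * m)) ≡ 2 * (p + suc m)
          lemma = solve-∀
  upper-min : ∀ {j α} k → α ↭ range (o + j) k → Dumont α → k ≢ 0 → Odd (suc (o + j))
  upper-min {j} zero    _  _  k≢0 = contradiction refl k≢0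
  upper-min {j} (suc k) α↭ dα _   = Dumont-range-min (o + j) k α↭ dα
  to′ : Dumont132 o (suc (suc (2 * m))) π → ∃[ s ] ∃[ r ] s + r ≡ m × Piece p m s r π
  to′ dπ with Dumont132-split o (suc (2 * m)) dπ
  ... | j , k , j+k≡ , α , β , dα@((α↭ , _) , dα′) , (pβ@(β↭ , _) , dMβ) , refl
    with to (Dumont-∷ (lower-<-max o j+k≡ β↭)) dMβ
  ... | inj₁ (odd-M , _) = contradiction even-M (Odd⇒¬Even {M} odd-M)
  ... | inj₂ (_ , β≢[] , dβ)
    with s , r , s+r≡m , refl , refl ←
           split-sizes p m j k j+k≡ (λ { refl → β≢[] (↭-empty-inv β↭) }) (upper-min k α↭ dα′) =
    s , r , s+r≡m , α , β , dα , (pβ , dβ) , refl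
  from′ : ∃[ s ] ∃[ r ] s + r ≡ m × Piece p m s r π → Dumont132 o (suc (suc (2 * m))) π
  from′ (s , r , s+r≡m , α , β , dα , (pβ@(β↭ , _) , dβ) , refl) =
    Dumont132-glue o (lowerSize+upperSize s r s+r≡m) dα pβ
      (from (Dumont-∷ (lower-<-max o (lowerSize+upperSize s r s+r≡m) β↭))
            (inj₂ (even-M , (λ { refl → lowerSize≢0 m s (sym (Perm132-length pβ)) }) , dβ)))

-- Enumerating 132-avoiding Dumont permutations

Dumont132-zero-enumeration : ∀ o → Enumeration (Dumont132 o 0) 1
Dumont132-zero-enumeration o = enumeration-resp (λ π → ⇔-sym (Dumont132-zero o π)) (singleton [])

Dumont132-odd-enumeration : ∀ p m {c} → Enumeration (Dumont132 (2 * p) (2 * m)) c →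
                            Enumeration (Dumont132 (2 * p) (suc (2 * m))) c
Dumont132-odd-enumeration p m {c} e = enumeration-resp (λ π → ⇔-sym (Dumont132-odd p m π))
  (subst (Enumeration _) (*-identityʳ c) (glue (suc (2 * p + 2 * m)) e (singleton [])
    λ ((α↭ , _) , _) → ↭-range-∉ (2 * p) (2 * m) α↭ ≤-refl))

-- Offsets stay even because the Dumont condition is not invariant under odd shifts of the values.
Enumerations : ℕ → Set
Enumerations m = ∀ p → Enumeration (Dumont132 (2 * p) (2 * m)) (catalan m)
                      × Enumeration (Dumont132 (2 * p) (suc (2 * m))) (catalan m)

Dumont132-even-enumeration : ∀ m → (∀ {s} → s ≤ m → Enumerations s) →
                             ∀ p → Enumeration (Dumont132 (2 * p) (2 * suc m)) (catalan (suc m))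
Dumont132-even-enumeration m enumerations p =
  subst₂ (λ n c → Enumeration (Dumont132 (2 * p) n) c) (sym (*-suc 2 m)) (sym (catalan-suc m))
    (enumeration-resp (λ π → ⇔-sym (Dumont132-even p m π)) (splitUnion m piece disjoint))
  where
  o = 2 * p
  M = suc (2 * p + suc (2 * m))
  upper-∉ : ∀ s r → s + r ≡ m → ∀ {α} → Dumont132 (o + lowerSize m s) (upperSize s r) α → M ∉ α
  upper-∉ s r s+r≡m ((α↭ , _) , _) = ↭-range-∉ (o + lowerSize m s) (upperSize s r) α↭
    (s≤s (≤-reflexive (trans (+-assoc o (lowerSize m s) _) (cong (o +_) (lowerSize+upperSize s r s+r≡m)))))
  piece : ∀ s r → s + r ≡ m → Enumeration (Piece p m s r) (catalan s * catalan r)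
  piece zero    r refl =
    glue M (Dumont132-zero-enumeration (o + suc (2 * m))) (proj₂ (enumerations ≤-refl p)) (upper-∉ 0 r refl)
  piece (suc s) r s+r≡m =
    subst (Enumeration _) (*-comm (catalan r) (catalan (suc s))) (glue M upper lower (upper-∉ (suc s) r s+r≡m))
    where
    upper : Enumeration (Dumont132 (o + 2 * suc s) (suc (2 * r))) (catalan r)
    upper = subst (λ o′ → Enumeration (Dumont132 o′ (suc (2 * r))) (catalan r)) (*-distribˡ-+ 2 p (suc s))
                  (proj₂ (enumerations (subst (r ≤_) s+r≡m (m≤n+m r (suc s))) (p + suc s)))
    lower : Enumeration (Dumont132 o (2 * suc s)) (catalan (suc s))
    lower = proj₁ (enumerations (subst (suc s ≤_) s+r≡m (m≤m+n (suc s) r)) p)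
  disjoint : ∀ {s r s′ r′ π} → s + r ≡ m → s′ + r′ ≡ m → Piece p m s r π → Piece p m s′ r′ π → s ≡ s′
  disjoint {s} {r} {s′} {r′} s+r≡m s′+r′≡m (α , _ , dα , _ , refl) (α′ , _ , dα′ , _ , eq) =
    let α≡α′ , _ = ++-∷-cancel α α′ (upper-∉ s r s+r≡m dα) (upper-∉ s′ r′ s′+r′≡m dα′) eq
    in upperSize-injective s+r≡m s′+r′≡m
         (trans (sym (Perm132-length (proj₁ dα))) (trans (cong length α≡α′) (Perm132-length (proj₁ dα′))))

Dumont132-enumerations : ∀ m → Enumerations m
Dumont132-enumerations = <-rec Enumerations step
  where
  step : ∀ m → (∀ {s} → s < m → Enumerations s) → Enumerations m
  step zero    _            p = let E = Dumont132-zero-enumeration (2 * p) in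
    E , Dumont132-odd-enumeration p 0 E
  step (suc m) enumerations p = let E = Dumont132-even-enumeration m (λ s≤m → enumerations (s≤s s≤m)) p in
    E , Dumont132-odd-enumeration p (suc m) E

⌊2*m/2⌋≡m : ∀ m → ⌊ 2 * m /2⌋ ≡ m
⌊2*m/2⌋≡m m = sym (trans (n≡⌊n+n/2⌋ m) (cong (λ n → ⌊ m + n /2⌋) (sym (+-identityʳ m))))

⌊1+2*m/2⌋≡m : ∀ m → ⌊ suc (2 * m) /2⌋ ≡ m
⌊1+2*m/2⌋≡m m = sym (trans (n≡⌈n+n/2⌉ m) (cong (λ n → ⌈ m + n /2⌉) (sym (+-identityʳ m))))

Dumont132-enumeration : ∀ n → Enumeration (Dumont132 0 n) (catalan ⌊ n /2⌋)
Dumont132-enumeration n with even-or-odd n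
... | m , inj₁ refl = subst (Enumeration _) (cong catalan (sym (⌊2*m/2⌋≡m m))) (proj₁ (Dumont132-enumerations m 0))
... | m , inj₂ refl = subst (Enumeration _) (cong catalan (sym (⌊1+2*m/2⌋≡m m))) (proj₂ (Dumont132-enumerations m 0))

-- Descents and the coefficients

evens-range : ∀ o n → Even o → length (filter even? (range o n)) ≡ ⌊ n /2⌋
evens-range o zero          _      = refl
evens-range o (suc zero)    even-o = cong length (filter-reject even? {x = suc o} {xs = []} (Even⇒¬Even-suc {o} even-o))
evens-range o (suc (suc n)) even-o = begin
  length (filter even? (suc o ∷ 2 + o ∷ range (2 + o) n))
    ≡⟨ cong length (filter-reject even? {x = suc o} (Even⇒¬Even-suc {o} even-o)) ⟩
  length (filter even? (2 + o ∷ range (2 + o) n))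
    ≡⟨ cong length (filter-accept even? {x = 2 + o} even-o) ⟩
  suc (length (filter even? (range (2 + o) n)))
    ≡⟨ cong suc (evens-range (2 + o) n even-o) ⟩
  suc ⌊ n /2⌋ ∎
  where open ≡-Reasoning

descents-Dumont132 : ∀ n {π} → Dumont132 0 n π → descents π ≡ ⌊ n /2⌋
descents-Dumont132 n {π} ((π↭ , _) , d) =
  trans (descents≡evens π d) (trans (↭-length (filter-↭ even? π↭)) (evens-range 0 n refl))

≡ᵇ-true : ∀ {m n} → m ≡ n → (m ≡ᵇ n) ≡ true
≡ᵇ-true {m} {n} = dec-true (m ≟ n)

≡ᵇ-false : ∀ {m n} → m ≢ n → (m ≡ᵇ n) ≡ false
≡ᵇ-false {m} {n} = dec-false (m ≟ n)

coeff-⌊n/2⌋ : ∀ n → coeff n ⌊ n /2⌋ ≡ catalan ⌊ n /2⌋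
coeff-⌊n/2⌋ n with even-or-odd n
... | m , inj₁ refl rewrite ⌊2*m/2⌋≡m m | ≡ᵇ-true {2 * m} refl = refl
... | m , inj₂ refl rewrite ⌊1+2*m/2⌋≡m m | ≡ᵇ-false (1+n≢n {2 * m}) | ≡ᵇ-true {2 * m} refl = refl

coeff-≢ : ∀ {n k} → ⌊ n /2⌋ ≢ k → coeff n k ≡ 0
coeff-≢ {n} {k} ⌊n/2⌋≢k with even-or-odd n
... | m , inj₁ refl rewrite ⌊2*m/2⌋≡m m
  | ≡ᵇ-false (⌊n/2⌋≢k ∘ *-cancelˡ-≡ m k 2) | ≡ᵇ-false (even≢odd m k) = refl
... | m , inj₂ refl rewrite ⌊1+2*m/2⌋≡m m
  | ≡ᵇ-false (even≢odd k m ∘ sym) | ≡ᵇ-false (⌊n/2⌋≢k ∘ *-cancelˡ-≡ m k 2 ∘ suc-injective) = refl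

oneTo-Dumont132 : ∀ n {π} → π ↭ oneTo n × Dumont π × Avoids132 π → Dumont132 0 n π
oneTo-Dumont132 n {π} (π↭ , d , av) = (subst (π ↭_) (oneTo≡range n) π↭ , av) , d

enumeration-by-descents : ∀ n k →
  Enumeration (λ π → π ↭ oneTo n × Dumont π × Avoids132 π × descents π ≡ k) (coeff n k)
enumeration-by-descents n k with ⌊ n /2⌋ ≟ k
... | yes refl = subst (Enumeration _) (sym (coeff-⌊n/2⌋ n)) (enumeration-resp reshape (Dumont132-enumeration n))
  where
  reshape : ∀ π → Dumont132 0 n π ⇔ (π ↭ oneTo n × Dumont π × Avoids132 π × descents π ≡ ⌊ n /2⌋)
  reshape π = mk⇔
    (λ dπ@((π↭ , av) , d) → subst (π ↭_) (sym (oneTo≡range n)) π↭ , d , av , descents-Dumont132 n dπ)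
    (λ (π↭ , d , av , _) → oneTo-Dumont132 n (π↭ , d , av))
... | no ⌊n/2⌋≢k = subst (Enumeration _) (sym (coeff-≢ ⌊n/2⌋≢k)) (empty λ π (π↭ , d , av , desc) →
  ⌊n/2⌋≢k (trans (sym (descents-Dumont132 n (oneTo-Dumont132 n (π↭ , d , av)))) desc))

corollary2p15 : (n k : ℕ) →
    ∃[ L ] (Unique L
    × (∀ (π : List ℕ) → (π ∈ L ⇔ (π ↭ oneTo n × Dumont π × Avoids132 π × descents π ≡ k)))
    × length L ≡ coeff n k)
corollary2p15 n k = elements e , unique e , ∈⇔ e , length≡ e
  where e = enumeration-by-descents n k
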